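{- For all formulas $A, B$ of $L$ and every truth value assignment $V$: $$(\Delta[V;A])^{A},\; (\Delta[V;B])^{B} \vdash (\Delta[V;A \& B])^{A \& B}.$$
   Context: **Language.** $L$ is the propositional language whose formulas are built from the atomic formulas $p_1, p_2, \dots$ using the binary connectives $\to$, $\vee$ and $\&$. Iterated connectives associate to the right. All formulas are arranged in a fixed decidable linear order $R$. **Semantics.** A truth value assignment $V$ maps formulas to $\{T,F\}$ according to the classical truth conditions. **Notation.** - $\Delta[V;A]$ is the set of atomic subformulas $C$ of $A$ with $V(C)=F$. - For a finite set $K$ of formulas with distinct elements $B_1, \dots, B_n$ listed in the order $R$, $(K)^{A}$ is $A$ if $K$ is empty, and $B_1 \vee \dots \vee B_n \vee A$ (that is, $B_1 \vee (\dots \vee (B_n \vee A))$) otherwise. **Calculus.** $\vdash$ denotes derivability in the classical positive propositional calculus. Its axiom schemes are: - $A \to B \to A$; - $(A \to B \to C) \to (A \to B) \to A \to C$; - $((A \to B) \to A) \to A$; - $A \to (A \vee B)$; - $A \to (B \vee A)$; - $(A \to C) \to (B \to C) \to (A \vee B) \to C$; - $(A \& B) \to A$; - $(A \& B) \to B$; - $A \to B \to (A \& B)$. Its only rule is modus ponens. -}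

module Defs where

open import Level using (0ℓ)
open import Data.Nat using (ℕ)
import Data.Nat.Properties as ℕP
open import Data.Bool using (Bool; true; false; _∧_; _∨_; not; if_then_else_)
open import Data.List using (List; []; _∷_; _++_; filter; deduplicate)
open import Data.List.Membership.Propositional using (_∈_)
open import Relation.Binary.PropositionalEquality using (_≡_; refl; cong; cong₂)
open import Relation.Binary using (Rel; IsDecTotalOrder; DecTotalOrder; DecidableEquality)
open import Relation.Nullary using (yes; no; ¬_)
import Data.List.Sort.InsertionSort as InsSort

infixr 5 _⇒_
infixr 6 _∨ᶠ_
infixr 7 _&_

data Formula : Set where
  p    : ℕ → Formula
  _⇒_  : Formula → Formula → Formula
  _∨ᶠ_ : Formula → Formula → Formula
  _&_  : Formula → Formula → Formula

Assignment : Set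
Assignment = ℕ → Bool

val : Assignment → Formula → Bool
val V (p i)    = V i
val V (A ⇒ B)  = not (val V A) ∨ val V B
val V (A ∨ᶠ B) = val V A ∨ val V B
val V (A & B)  = val V A ∧ val V B

_≟F_ : DecidableEquality Formula
p i ≟F p j with i ℕP.≟ j
... | yes refl = yes refl
... | no ne = no λ { refl → ne refl }
p _ ≟F (_ ⇒ _) = no λ ()
p _ ≟F (_ ∨ᶠ _) = no λ ()
p _ ≟F (_ & _) = no λ ()
(_ ⇒ _) ≟F p _ = no λ ()
(A ⇒ B) ≟F (C ⇒ D) with A ≟F C | B ≟F D
... | yes refl | yes refl = yes refl
... | no ne | _ = no λ { refl → ne refl }
... | yes _ | no ne = no λ { refl → ne refl }
(_ ⇒ _) ≟F (_ ∨ᶠ _) = no λ ()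
(_ ⇒ _) ≟F (_ & _) = no λ ()
(_ ∨ᶠ _) ≟F p _ = no λ ()
(_ ∨ᶠ _) ≟F (_ ⇒ _) = no λ ()
(A ∨ᶠ B) ≟F (C ∨ᶠ D) with A ≟F C | B ≟F D
... | yes refl | yes refl = yes refl
... | no ne | _ = no λ { refl → ne refl }
... | yes _ | no ne = no λ { refl → ne refl }
(_ ∨ᶠ _) ≟F (_ & _) = no λ ()
(_ & _) ≟F p _ = no λ ()
(_ & _) ≟F (_ ⇒ _) = no λ ()
(_ & _) ≟F (_ ∨ᶠ _) = no λ ()
(A & B) ≟F (C & D) with A ≟F C | B ≟F D
... | yes refl | yes refl = yes refl
... | no ne | _ = no λ { refl → ne refl }
... | yes _ | no ne = no λ { refl → ne refl }

atoms : Formula → List Formula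
atoms (p i)    = p i ∷ []
atoms (A ⇒ B)  = atoms A ++ atoms B
atoms (A ∨ᶠ B) = atoms A ++ atoms B
atoms (A & B)  = atoms A ++ atoms B

isFalse : Assignment → Formula → Bool
isFalse V C = not (val V C)

Δ : Assignment → Formula → List Formula
Δ V A = deduplicate _≟F_ (Data.List.filterᵇ (isFalse V) (atoms A))

record LinOrder : Set₁ where
  field
    _≤R_ : Rel Formula 0ℓ
    isDecTotalOrder : IsDecTotalOrder _≡_ _≤R_

  bundle : DecTotalOrder 0ℓ 0ℓ 0ℓ
  bundle = record { Carrier = Formula ; _≈_ = _≡_ ; _≤_ = _≤R_
                  ; isDecTotalOrder = isDecTotalOrder }

sortR : LinOrder → List Formula → List Formula
sortR R = InsSort.sort (LinOrder.bundle R)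

disjPrefix : List Formula → Formula → Formula
disjPrefix []       A = A
disjPrefix (B ∷ Bs) A = B ∨ᶠ disjPrefix Bs A

-- (K)^A, where K is a finite set given as a duplicate-free list; its
-- elements are listed in the order R.
_^⟨_⟩_ : List Formula → LinOrder → Formula → Formula
K ^⟨ R ⟩ A = disjPrefix (sortR R K) A

infix 4 _⊢_
data _⊢_ (Γ : List Formula) : Formula → Set where
  hyp : ∀ {A} → A ∈ Γ → Γ ⊢ A
  ax1 : ∀ {A B} → Γ ⊢ A ⇒ B ⇒ A
  ax2 : ∀ {A B C} → Γ ⊢ (A ⇒ B ⇒ C) ⇒ (A ⇒ B) ⇒ A ⇒ C
  ax3 : ∀ {A B} → Γ ⊢ ((A ⇒ B) ⇒ A) ⇒ A
  ax4 : ∀ {A B} → Γ ⊢ A ⇒ (A ∨ᶠ B)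
  ax5 : ∀ {A B} → Γ ⊢ A ⇒ (B ∨ᶠ A)
  ax6 : ∀ {A B C} → Γ ⊢ (A ⇒ C) ⇒ (B ⇒ C) ⇒ (A ∨ᶠ B) ⇒ C
  ax7 : ∀ {A B} → Γ ⊢ (A & B) ⇒ A
  ax8 : ∀ {A B} → Γ ⊢ (A & B) ⇒ B
  ax9 : ∀ {A B} → Γ ⊢ A ⇒ B ⇒ (A & B)
  mp  : ∀ {A B} → Γ ⊢ A ⇒ B → Γ ⊢ A → Γ ⊢ B

{-# OPTIONS --safe #-}
-- Each hypothesis is a disjunction whose side disjuncts are atoms of Δ[V;A & B],
-- which already occur in the conclusion. Eliminating both disjunctions by cases,
-- every branch but one ends in an atom of the conclusion; the remaining branch
-- has A and B, hence A & B, the last disjunct of the conclusion.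
module Submission where

open import Defs
open import Data.List using (List; []; _∷_)
open import Data.List.Membership.Propositional using (_∈_)
open import Data.List.Membership.Propositional.Properties
  using (∈-deduplicate⁺; ∈-deduplicate⁻)
open import Data.List.Relation.Unary.Any using (here; there)
open import Data.List.Relation.Binary.Subset.Propositional using (_⊆_)
open import Data.List.Relation.Binary.Subset.Propositional.Properties
  using (xs⊆x∷xs; xs⊆xs++ys; xs⊆ys++xs; filter⁺′; ⊆-reflexive-↭)
open import Data.List.Relation.Binary.Permutation.Propositional using (↭-sym)
import Data.List.Sort.InsertionSort.Properties as InsertionSort
open import Function using (id; _∘_)
open import Relation.Binary.PropositionalEquality using (refl)

private variable
  Γ Γ′ : List Formula
  A B C X Y Z : Formula
  Ls : List Formula

⊢-mono : Γ ⊆ Γ′ → Γ ⊢ A → Γ′ ⊢ A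
⊢-mono Γ⊆Γ′ (hyp A∈Γ) = hyp (Γ⊆Γ′ A∈Γ)
⊢-mono Γ⊆Γ′ ax1 = ax1
⊢-mono Γ⊆Γ′ ax2 = ax2
⊢-mono Γ⊆Γ′ ax3 = ax3
⊢-mono Γ⊆Γ′ ax4 = ax4
⊢-mono Γ⊆Γ′ ax5 = ax5
⊢-mono Γ⊆Γ′ ax6 = ax6
⊢-mono Γ⊆Γ′ ax7 = ax7
⊢-mono Γ⊆Γ′ ax8 = ax8
⊢-mono Γ⊆Γ′ ax9 = ax9
⊢-mono Γ⊆Γ′ (mp f x) = mp (⊢-mono Γ⊆Γ′ f) (⊢-mono Γ⊆Γ′ x)

⊢-id : Γ ⊢ A ⇒ A
⊢-id {A = A} = mp (mp ax2 (ax1 {B = A ⇒ A})) (ax1 {B = A})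

⇒-trans : Γ ⊢ X ⇒ Y → Γ ⊢ Y ⇒ Z → Γ ⊢ X ⇒ Z
⇒-trans f g = mp (mp ax2 (mp ax1 g)) f

deduction : (A ∷ Γ) ⊢ B → Γ ⊢ A ⇒ B
deduction (hyp (here refl)) = ⊢-id
deduction (hyp (there B∈Γ)) = mp ax1 (hyp B∈Γ)
deduction ax1 = mp ax1 ax1
deduction ax2 = mp ax1 ax2
deduction ax3 = mp ax1 ax3
deduction ax4 = mp ax1 ax4
deduction ax5 = mp ax1 ax5
deduction ax6 = mp ax1 ax6
deduction ax7 = mp ax1 ax7
deduction ax8 = mp ax1 ax8
deduction ax9 = mp ax1 ax9
deduction (mp f x) = mp (mp ax2 (deduction f)) (deduction x)

disjPrefix-introʳ : ∀ Ls → Γ ⊢ Y ⇒ disjPrefix Ls Y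
disjPrefix-introʳ []       = ⊢-id
disjPrefix-introʳ (L ∷ Ls) = ⇒-trans (disjPrefix-introʳ Ls) ax5

disjPrefix-introˡ : C ∈ Ls → Γ ⊢ C ⇒ disjPrefix Ls Y
disjPrefix-introˡ (here refl) = ax4
disjPrefix-introˡ (there C∈Ls) = ⇒-trans (disjPrefix-introˡ C∈Ls) ax5

disjPrefix-elim : ∀ Ks → (∀ {C} → C ∈ Ks → Γ ⊢ C ⇒ Z) → Γ ⊢ X ⇒ Z →
                  Γ ⊢ disjPrefix Ks X ⇒ Z
disjPrefix-elim []       _ X⇒Z = X⇒Z
disjPrefix-elim (K ∷ Ks) Ks⇒Z X⇒Z =
  mp (mp ax6 (Ks⇒Z (here refl))) (disjPrefix-elim Ks (Ks⇒Z ∘ there) X⇒Z)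

disjPrefix-map : ∀ Ks → Ks ⊆ Ls → Γ ⊢ X ⇒ disjPrefix Ls Y →
                 Γ ⊢ disjPrefix Ks X ⇒ disjPrefix Ls Y
disjPrefix-map Ks Ks⊆Ls = disjPrefix-elim Ks (disjPrefix-introˡ ∘ Ks⊆Ls)

disjPrefix-&-intro : ∀ Ks Ms → Ks ⊆ Ls → Ms ⊆ Ls →
                     Γ ⊢ disjPrefix Ks X → Γ ⊢ disjPrefix Ms Y →
                     Γ ⊢ disjPrefix Ls (X & Y)
disjPrefix-&-intro {Ls = Ls} {Γ = Γ} {X = X} {Y = Y} Ks Ms Ks⊆Ls Ms⊆Ls ⊢Ks∨X ⊢Ms∨Y =
  mp (disjPrefix-map Ks Ks⊆Ls (deduction X⊢Ls∨X&Y)) ⊢Ks∨X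
  where
  XY⊢Ls∨X&Y : (Y ∷ X ∷ Γ) ⊢ disjPrefix Ls (X & Y)
  XY⊢Ls∨X&Y =
    mp (disjPrefix-introʳ Ls) (mp (mp ax9 (hyp (there (here refl)))) (hyp (here refl)))

  X⊢Ls∨X&Y : (X ∷ Γ) ⊢ disjPrefix Ls (X & Y)
  X⊢Ls∨X&Y =
    mp (disjPrefix-map Ms Ms⊆Ls (deduction XY⊢Ls∨X&Y)) (⊢-mono (xs⊆x∷xs _ _) ⊢Ms∨Y)

sortR-mono : ∀ R {xs ys} → xs ⊆ ys → sortR R xs ⊆ sortR R ys
sortR-mono R {xs} {ys} xs⊆ys =
  ⊆-reflexive-↭ (↭-sym (InsertionSort.sort-↭ (LinOrder.bundle R) ys))
  ∘ xs⊆ys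
  ∘ ⊆-reflexive-↭ (InsertionSort.sort-↭ (LinOrder.bundle R) xs)

Δ-mono : ∀ V A B → atoms A ⊆ atoms B → Δ V A ⊆ Δ V B
Δ-mono V A B atomsA⊆atomsB =
  ∈-deduplicate⁺ _≟F_ ∘ filter⁺′ _ _ id atomsA⊆atomsB ∘ ∈-deduplicate⁻ _≟F_ _

mainTheorem17 : (R : LinOrder) (A B : Formula) (V : Assignment) →
    ((Δ V A ^⟨ R ⟩ A) ∷ (Δ V B ^⟨ R ⟩ B) ∷ []) ⊢ (Δ V (A & B) ^⟨ R ⟩ (A & B))
mainTheorem17 R A B V =
  disjPrefix-&-intro (sortR R (Δ V A)) (sortR R (Δ V B))
    (sortR-mono R (Δ-mono V A (A & B) (xs⊆xs++ys (atoms A) (atoms B))))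
    (sortR-mono R (Δ-mono V B (A & B) (xs⊆ys++xs (atoms B) (atoms A))))
    (hyp (here refl)) (hyp (there (here refl)))
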